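{- Let $(X,d)$ be an isometrically homogeneous ultrametric space with finite distance scale $d(X\times X)=\{\varepsilon_0,\varepsilon_1,\dots,\varepsilon_n\}$, where $0=\varepsilon_0<\varepsilon_1<\dots<\varepsilon_n$. Then every kaleidoscopical configuration $K$ in $X$ (with respect to the action of the isometry group $\mathrm{Iso}(X)$) is $(E_{\varepsilon_0},\dots,E_{\varepsilon_n})$-splittable, i.e. for every $k<n$ the set $K$ is either $E_{\varepsilon_{k+1}}/E_{\varepsilon_k}$-parallel or $E_{\varepsilon_{k+1}}/E_{\varepsilon_k}$-orthogonal.
   Context: $X$ is isometrically homogeneous if $\mathrm{Iso}(X)$ acts transitively on $X$. For $\varepsilon\ge0$, $E_\varepsilon=\{(x,y)\in X^2:d(x,y)\le\varepsilon\}$, an $\mathrm{Iso}(X)$-invariant equivalence relation (so $E_{\varepsilon_0}$ is the diagonal and $E_{\varepsilon_n}=X\times X$). For an equivalence relation $E$, $[x]_E$ is the class of $x$ and $[K]_E=\bigcup_{x\in K}[x]_E$. For $E\subseteq F$, $K$ is $F/E$-parallel if $[K]_E\cap[x]_F=[x]_F$ for all $x\in K$, and $F/E$-orthogonal if $[K]_E\cap[x]_F=[x]_E$ for all $x\in K$. $K\subseteq X$ is a kaleidoscopical configuration if there is a map $\chi:X\to C$ with $\chi|_{gK}:gK\to C$ bijective for every $g\in\mathrm{Iso}(X)$. -}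

module Defs where

open import Data.Nat using (ℕ; suc; _⊔_) renaming (_≤_ to _≤ℕ_)
open import Data.Fin using (Fin; zero; toℕ; _≤_; _<_; inject₁; fromℕ<)
open import Data.Product using (Σ; ∃; _×_; _,_)
open import Data.Sum using (_⊎_)
open import Function.Bundles using (_⇔_)
open import Relation.Binary.PropositionalEquality using (_≡_)

-- A metric with finite distance scale {ε₀ < ε₁ < … < εₙ}, ε₀ = 0, is
-- encoded (up to the order-isomorphism εᵢ ↦ i) by a distance function
-- into Fin (suc n): d x y ≡ i means d(x,y) = εᵢ.
record FiniteScaleUltrametric (X : Set) (n : ℕ) : Set where
  field
    d          : X → X → Fin (suc n)
    d-zero⇒≡   : ∀ x y → d x y ≡ zero → x ≡ y
    d-refl     : ∀ x → d x x ≡ zero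
    d-sym      : ∀ x y → d x y ≡ d y x
    ultra      : ∀ x y z → toℕ (d x z) ≤ℕ toℕ (d x y) ⊔ toℕ (d y z)
    scale-onto : ∀ (i : Fin (suc n)) → ∃ λ x → ∃ λ y → d x y ≡ i

module _ {X : Set} {n : ℕ} (M : FiniteScaleUltrametric X n) where
  open FiniteScaleUltrametric M

  record Isometry : Set where
    field
      to        : X → X
      from      : X → X
      to-from   : ∀ y → to (from y) ≡ y
      from-to   : ∀ x → from (to x) ≡ x
      preserves : ∀ x y → d (to x) (to y) ≡ d x y

  IsometricallyHomogeneous : Set
  IsometricallyHomogeneous = ∀ x y → Σ Isometry λ g → Isometry.to g x ≡ y

  image : Isometry → (X → Set) → (X → Set)
  image g K y = Σ X λ x → K x × Isometry.to g x ≡ y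

  Kaleidoscopical : (X → Set) → Set₁
  Kaleidoscopical K =
    Σ Set λ C → Σ (X → C) λ χ → ∀ (g : Isometry) →
      (∀ y y' → image g K y → image g K y' → χ y ≡ χ y' → y ≡ y')
      × (∀ c → Σ X λ y → image g K y × χ y ≡ c)

  E : Fin (suc n) → X → X → Set
  E i x y = d x y ≤ i

module _ {X : Set} where
  class : (X → X → Set) → X → X → Set
  class R x y = R x y

  saturation : (X → X → Set) → (X → Set) → X → Set
  saturation R K y = Σ X λ x → K x × R x y

  Parallel : (F E : X → X → Set) → (X → Set) → Set
  Parallel F E K = ∀ x → K x → ∀ y →
    (saturation E K y × class F x y) ⇔ class F x y

  Orthogonal : (F E : X → X → Set) → (X → Set) → Set
  Orthogonal F E K = ∀ x → K x → ∀ y →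
    (saturation E K y × class F x y) ⇔ class E x y

-- Fix a level m with suc m in the distance scale, and call two points adjacent
-- when their distance is exactly suc m.  Homogeneity yields, for any adjacent
-- a and b, an isometry that exchanges the m-balls around a and b and fixes
-- every point outside them.  Precomposing with such exchanges shows that a
-- colouring χ which is bijective on every gK cannot give the same colour to two
-- adjacent points if K itself contains two adjacent points; and, applied to a
-- point x of K and an adjacent point q, it shows that either some point of K
-- lies in the m-ball around q, or two adjacent points share a colour.  The
-- first alternative makes K parallel, the second makes it orthogonal.
module Submission where

open import Defs
open import Data.Nat using (ℕ; suc; z≤n; _≤_; _<_; _≤?_)
open import Data.Nat.Properties
  using ( ≤-refl; ≤-trans; ≤-antisym; ≤-reflexive; ≤-<-trans; <⇒≤; <⇒≱; ≰⇒>; ≮⇒≥; n≤1+n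
        ; ⊔-lub; ⊔-pres-<m)
open import Data.Fin using (Fin; inject₁; toℕ)
open import Data.Fin.Properties using (toℕ-injective; toℕ-inject₁)
open import Data.Sum using (_⊎_; inj₁; inj₂)
open import Data.Product using (Σ; _×_; _,_; proj₁; proj₂)
open import Data.Empty using (⊥-elim)
open import Function using (_∘_)
open import Function.Bundles using (mk⇔)
open import Relation.Nullary using (¬_; Dec; yes; no)
open import Relation.Binary.PropositionalEquality
  using (_≡_; refl; sym; trans; cong; cong₂; subst; module ≡-Reasoning)

module _ {X : Set} {n : ℕ} (M : FiniteScaleUltrametric X n) where
  open FiniteScaleUltrametric M
  open Isometry
  open ≡-Reasoning

  dist : X → X → ℕ
  dist x y = toℕ (d x y)

  dist-sym : ∀ x y → dist x y ≡ dist y x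
  dist-sym x y = cong toℕ (d-sym x y)

  dist-flip : ∀ {x y x' y'} → dist x' y' ≡ dist x y → dist y' x' ≡ dist y x
  dist-flip {x} {y} {x'} {y'} e = trans (dist-sym y' x') (trans e (dist-sym x y))

  Close : ℕ → X → X → Set
  Close r x y = dist x y ≤ r

  close-refl : ∀ r x → Close r x x
  close-refl r x = subst (_≤ r) (sym (cong toℕ (d-refl x))) z≤n

  close-sym : ∀ {r x y} → Close r x y → Close r y x
  close-sym {r} {x} {y} = subst (_≤ r) (dist-sym x y)

  close-trans : ∀ {r x y z} → Close r x y → Close r y z → Close r x z
  close-trans {x = x} {y} {z} xy yz = ≤-trans (ultra x y z) (⊔-lub xy yz)

  dist-absorb : ∀ {a b c} → dist a b ≤ dist b c → dist a c ≤ dist b c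
  dist-absorb ab≤bc = close-trans ab≤bc ≤-refl

  isosceles : ∀ {a b c} → dist a b < dist b c → dist a c ≡ dist b c
  isosceles {a} {b} {c} ab<bc = ≤-antisym (dist-absorb (<⇒≤ ab<bc))
    (≮⇒≥ λ ac<bc → <⇒≱ (⊔-pres-<m ba<bc ac<bc) (ultra b a c))
    where
    ba<bc : dist b a < dist b c
    ba<bc = subst (_< dist b c) (dist-sym a b) ab<bc

  ¬close⇒far : ∀ {r x y} → ¬ Close r x y → r < dist y x
  ¬close⇒far ¬xy = ≰⇒> (¬xy ∘ close-sym)

  dist-recentre : ∀ {r p a b} → Close r p a → r < dist a b → dist p b ≡ dist a b
  dist-recentre pa r<ab = isosceles (≤-<-trans pa r<ab)

  outside-equidistant : ∀ {r a b c} → dist a b ≤ suc r → r < dist a c → r < dist b c →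
                        dist a c ≡ dist b c
  outside-equidistant {a = a} {b} ab r<ac r<bc = ≤-antisym
    (dist-absorb (≤-trans ab r<bc))
    (dist-absorb (≤-trans (≤-reflexive (dist-sym b a)) (≤-trans ab r<ac)))

  dist-between-balls : ∀ {r x y a b} → Close r x a → Close r y b → r < dist a b →
                       dist x y ≡ dist a b
  dist-between-balls {r} {x} {y} {a} {b} xa yb r<ab = begin
    dist x y  ≡⟨ dist-recentre xa r<ay ⟩
    dist a y  ≡⟨ dist-flip yb≡ab ⟩
    dist a b  ∎
    where
    yb≡ab : dist y a ≡ dist b a
    yb≡ab = dist-recentre yb (subst (r <_) (dist-sym a b) r<ab)
    r<ay : r < dist a y
    r<ay = subst (r <_) (sym (dist-flip yb≡ab)) r<ab

  dist-preserved : (g : Isometry M) → ∀ x y → dist (to g x) (to g y) ≡ dist x y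
  dist-preserved g x y = cong toℕ (preserves g x y)

  dist-preserved-from : (g : Isometry M) → ∀ x y → dist (from g x) (from g y) ≡ dist x y
  dist-preserved-from g x y =
    trans (sym (dist-preserved g (from g x) (from g y))) (cong₂ dist (to-from g x) (to-from g y))

  idᴵ : Isometry M
  idᴵ = record
    { to = λ x → x ; from = λ x → x ; to-from = λ _ → refl ; from-to = λ _ → refl
    ; preserves = λ _ _ → refl }

  _∘ᴵ_ : Isometry M → Isometry M → Isometry M
  g ∘ᴵ f = record
    { to = to g ∘ to f
    ; from = from f ∘ from g
    ; to-from = λ y → trans (cong (to g) (to-from f (from g y))) (to-from g y)
    ; from-to = λ x → trans (cong (from f) (from-to g (to f x))) (from-to f x)
    ; preserves = λ x y → trans (preserves g (to f x) (to f y)) (preserves f x y) }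

  module BallSwap (r : ℕ) (f g : X → X) (a b : X) where

    data Region (p : X) : Set where
      in-a    : Close r p a → Region p
      in-b    : ¬ Close r p a → Close r p b → Region p
      outside : ¬ Close r p a → ¬ Close r p b → Region p

    region : ∀ p → Region p
    region p with dist p a ≤? r | dist p b ≤? r
    ... | yes pa | _      = in-a pa
    ... | no ¬pa | yes pb = in-b ¬pa pb
    ... | no ¬pa | no ¬pb = outside ¬pa ¬pb

    act : ∀ {p} → Region p → X
    act {p} (in-a _)      = f p
    act {p} (in-b _ _)    = g p
    act {p} (outside _ _) = p

    swap : X → X
    swap p = act (region p)

    act-in-a : ∀ {p} → Close r p a → (ρ : Region p) → act ρ ≡ f p
    act-in-a _  (in-a _)        = refl
    act-in-a pa (in-b ¬pa _)    = ⊥-elim (¬pa pa)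
    act-in-a pa (outside ¬pa _) = ⊥-elim (¬pa pa)

    act-outside : ∀ {p} → ¬ Close r p a → ¬ Close r p b → (ρ : Region p) → act ρ ≡ p
    act-outside ¬pa _   (in-a pa)     = ⊥-elim (¬pa pa)
    act-outside _   ¬pb (in-b _ pb)   = ⊥-elim (¬pb pb)
    act-outside _   _   (outside _ _) = refl

  module BallSwapInverse (r : ℕ) {f g : X → X} {a b : X}
    (f∘g : ∀ y → f (g y) ≡ y) (g∘f : ∀ x → g (f x) ≡ x)
    (f-ball : ∀ {p} → Close r p a → Close r (f p) b)
    (g-ball : ∀ {p} → Close r p b → Close r (g p) a) where
    open BallSwap r f g a b
    private module S⁻ = BallSwap r g f b a

    act-cancel : ∀ {y} (ρ : S⁻.Region y) (σ : Region (S⁻.act ρ)) → act σ ≡ y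
    act-cancel (S⁻.in-a yb)       (in-a _)        = f∘g _
    act-cancel (S⁻.in-a yb)       (in-b ¬ga _)    = ⊥-elim (¬ga (g-ball yb))
    act-cancel (S⁻.in-a yb)       (outside ¬ga _) = ⊥-elim (¬ga (g-ball yb))
    act-cancel (S⁻.in-b ¬yb ya)   (in-a fa)       =
      ⊥-elim (¬yb (close-trans ya (close-trans (close-sym fa) (f-ball ya))))
    act-cancel (S⁻.in-b _ _)      (in-b _ _)      = g∘f _
    act-cancel (S⁻.in-b _ ya)     (outside _ ¬fb) = ⊥-elim (¬fb (f-ball ya))
    act-cancel (S⁻.outside _ ¬ya) (in-a ya)       = ⊥-elim (¬ya ya)
    act-cancel (S⁻.outside ¬yb _) (in-b _ yb)     = ⊥-elim (¬yb yb)
    act-cancel (S⁻.outside _ _)   (outside _ _)   = refl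

    swap-cancel : ∀ y → swap (S⁻.swap y) ≡ y
    swap-cancel y = act-cancel (S⁻.region y) (region _)

  module BallExchange (r : ℕ) (h : Isometry M) {a b : X} (h-a : to h a ≡ b)
                      (ab : dist a b ≤ suc r) where
    open BallSwap r (to h) (from h) a b
    private module S⁻ = BallSwap r (from h) (to h) b a

    to-ball : ∀ {p} → Close r p a → Close r (to h p) b
    to-ball {p} pa = subst (_≤ r) (sym hp-b) pa
      where
      hp-b : dist (to h p) b ≡ dist p a
      hp-b = trans (cong (dist (to h p)) (sym h-a)) (dist-preserved h p a)

    from-ball : ∀ {p} → Close r p b → Close r (from h p) a
    from-ball {p} pb = subst (_≤ r) (sym fp-a) pb
      where
      fp-a : dist (from h p) a ≡ dist p b
      fp-a = trans (sym (dist-preserved h (from h p) a)) (cong₂ dist (to-from h p) h-a)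

    private
      across : ∀ {x y} → Close r x a → ¬ Close r y a → Close r y b →
               dist (to h x) (from h y) ≡ dist x y
      across {x} {y} xa ¬ya yb = begin
        dist (to h x) (from h y) ≡⟨ dist-between-balls (to-ball xa) (from-ball yb) r<ba ⟩
        dist b a                 ≡⟨ dist-sym b a ⟩
        dist a b                 ≡⟨ dist-between-balls xa yb r<ab ⟨
        dist x y                 ∎
        where
        r<ab : r < dist a b
        r<ab = ≰⇒> λ ab' → ¬ya (close-trans yb (close-sym ab'))
        r<ba : r < dist b a
        r<ba = subst (r <_) (dist-sym a b) r<ab

      a-to-outside : ∀ {x y} → Close r x a → ¬ Close r y a → ¬ Close r y b →
                     dist (to h x) y ≡ dist x y
      a-to-outside {x} {y} xa ¬ya ¬yb = begin
        dist (to h x) y ≡⟨ dist-recentre (to-ball xa) (¬close⇒far ¬yb) ⟩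
        dist b y        ≡⟨ outside-equidistant ab (¬close⇒far ¬ya) (¬close⇒far ¬yb) ⟨
        dist a y        ≡⟨ dist-recentre xa (¬close⇒far ¬ya) ⟨
        dist x y        ∎

      b-to-outside : ∀ {x y} → Close r x b → ¬ Close r y a → ¬ Close r y b →
                     dist (from h x) y ≡ dist x y
      b-to-outside {x} {y} xb ¬ya ¬yb = begin
        dist (from h x) y ≡⟨ dist-recentre (from-ball xb) (¬close⇒far ¬ya) ⟩
        dist a y          ≡⟨ outside-equidistant ab (¬close⇒far ¬ya) (¬close⇒far ¬yb) ⟩
        dist b y          ≡⟨ dist-recentre xb (¬close⇒far ¬yb) ⟨
        dist x y          ∎

    act-preserves : ∀ {x y} (ρ : Region x) (σ : Region y) → dist (act ρ) (act σ) ≡ dist x y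
    act-preserves (in-a _)          (in-a _)          = dist-preserved h _ _
    act-preserves (in-a xa)         (in-b ¬ya yb)     = across xa ¬ya yb
    act-preserves (in-a xa)         (outside ¬ya ¬yb) = a-to-outside xa ¬ya ¬yb
    act-preserves (in-b ¬xa xb)     (in-a ya)         = dist-flip (across ya ¬xa xb)
    act-preserves (in-b _ _)        (in-b _ _)        = dist-preserved-from h _ _
    act-preserves (in-b _ xb)       (outside ¬ya ¬yb) = b-to-outside xb ¬ya ¬yb
    act-preserves (outside ¬xa ¬xb) (in-a ya)         = dist-flip (a-to-outside ya ¬xa ¬xb)
    act-preserves (outside ¬xa ¬xb) (in-b _ yb)       = dist-flip (b-to-outside yb ¬xa ¬xb)
    act-preserves (outside _ _)     (outside _ _)     = refl

    exchange : Isometry M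
    exchange = record
      { to        = swap
      ; from      = S⁻.swap
      ; to-from   = BallSwapInverse.swap-cancel r (to-from h) (from-to h) to-ball from-ball
      ; from-to   = BallSwapInverse.swap-cancel r (from-to h) (to-from h) from-ball to-ball
      ; preserves = λ x y → toℕ-injective (act-preserves (region x) (region y)) }

    exchange-centre : to exchange a ≡ b
    exchange-centre = trans (act-in-a (close-refl r a) (region a)) h-a

    exchange-outside : ∀ {p} → ¬ Close r p a → ¬ Close r p b → to exchange p ≡ p
    exchange-outside ¬pa ¬pb = act-outside ¬pa ¬pb (region _)

  scale-onto-suc : (k : Fin n) → Σ X λ p → Σ X λ p' → dist p p' ≡ suc (toℕ k)
  scale-onto-suc k with scale-onto (Fin.suc k)
  ... | p , p' , pp' = p , p' , cong toℕ pp'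

  module Level (homogeneous : IsometricallyHomogeneous M) {K : X → Set} (κ : Kaleidoscopical M K)
               (m : ℕ) where

    module Exchange {a b : X} (ab : dist a b ≤ suc m) =
      BallExchange m (proj₁ (homogeneous a b)) (proj₂ (homogeneous a b)) ab

    χ : X → proj₁ κ
    χ = proj₁ (proj₂ κ)

    χ-injective : ∀ g {y y'} → image M g K y → image M g K y' → χ y ≡ χ y' → y ≡ y'
    χ-injective g = proj₁ (proj₂ (proj₂ κ) g) _ _

    χ-onto : ∀ g c → Σ X λ y → image M g K y × χ y ≡ c
    χ-onto g = proj₂ (proj₂ (proj₂ κ) g)

    Adjacent : X → X → Set
    Adjacent x y = dist x y ≡ suc m

    adjacent⇒¬close : ∀ {x y} → Adjacent x y → ¬ Close m x y
    adjacent⇒¬close xy close = <⇒≱ (≤-reflexive (sym xy)) close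

    adjacent-sym : ∀ {x y} → Adjacent x y → Adjacent y x
    adjacent-sym {x} {y} = trans (dist-sym y x)

    adjacent-close : ∀ {x q v} → Adjacent x q → Close m v q → Adjacent x v
    adjacent-close xq vq =
      trans (dist-flip (dist-recentre vq (subst (m <_) (sym (adjacent-sym xq)) ≤-refl))) xq

    close⇒adjacent : ∀ {x y} → Close (suc m) x y → ¬ Close m x y → Adjacent x y
    close⇒adjacent le ¬close = ≤-antisym le (≰⇒> ¬close)

    MonochromaticPair : Set
    MonochromaticPair = Σ X λ u → Σ X λ u' → Adjacent u u' × χ u ≡ χ u'

    -- Move x to u by homogeneity, then exchange the m-balls around the image of
    -- y and around u': the composite maps x to u and y to u'.
    adjacent-in-K⇒¬monochromatic : ∀ {x y} → K x → K y → Adjacent x y → ¬ MonochromaticPair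
    adjacent-in-K⇒¬monochromatic {x} {y} Kx Ky xy (u , u' , uu' , χu≡χu') =
      adjacent⇒¬close (subst (Adjacent u) (sym u≡u') uu') (close-refl m u)
      where
      h : Isometry M
      h = proj₁ (homogeneous x u)
      h-x : to h x ≡ u
      h-x = proj₂ (homogeneous x u)
      hy-u : Adjacent (to h y) u
      hy-u = trans (cong (dist (to h y)) (sym h-x)) (trans (dist-preserved h y x) (adjacent-sym xy))
      module S = Exchange (close-trans (≤-reflexive hy-u) (≤-reflexive uu'))
      gx : to (S.exchange ∘ᴵ h) x ≡ u
      gx = trans (cong (to S.exchange) h-x)
                 (S.exchange-outside (adjacent⇒¬close (adjacent-sym hy-u))
                                     (adjacent⇒¬close uu'))
      u≡u' : u ≡ u'
      u≡u' = χ-injective (S.exchange ∘ᴵ h) (x , Kx , gx) (y , Ky , S.exchange-centre)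
                         χu≡χu'

    -- Some point v of K is coloured like x by the exchange of the m-balls around
    -- x and q; v cannot lie outside both balls, since χ is injective on K.
    close-in-K-or-monochromatic : ∀ {x q} → K x → Adjacent x q →
      (Σ X λ v → K v × Close m v q) ⊎ MonochromaticPair
    close-in-K-or-monochromatic {x} {q} Kx xq = from-preimage (χ-onto S.exchange (χ x))
      where
      module S = Exchange (≤-reflexive xq)
      from-preimage : (Σ X λ u → image M S.exchange K u × χ u ≡ χ x) →
                      (Σ X λ v → K v × Close m v q) ⊎ MonochromaticPair
      -- A `with` on these tests would also abstract them inside to S.exchange v.
      from-preimage (u , (v , Kv , sv≡u) , χu≡χx) =
        by-position (dist v q ≤? m) (dist v x ≤? m)
        where
        by-position : Dec (Close m v q) → Dec (Close m v x) →
                      (Σ X λ v → K v × Close m v q) ⊎ MonochromaticPair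
        by-position (yes vq) _        = inj₁ (v , Kv , vq)
        by-position (no _)   (yes vx) = inj₂ (x , u , adjacent-close xq uq , sym χu≡χx)
          where
          uq : Close m u q
          uq = subst (_≤ m) (sym (trans (cong₂ dist (sym sv≡u) (sym S.exchange-centre))
                                        (dist-preserved S.exchange v x))) vx
        by-position (no ¬vq) (no ¬vx) = ⊥-elim (¬vx (subst (Close m v) v≡x (close-refl m v)))
          where
          χv≡χx : χ v ≡ χ x
          χv≡χx = trans (cong χ (trans (sym (S.exchange-outside ¬vx ¬vq)) sv≡u)) χu≡χx
          v≡x : v ≡ x
          v≡x = χ-injective idᴵ (v , Kv , refl) (x , Kx , refl) χv≡χx

    parallel : ∀ {x₀ y₀} → K x₀ → K y₀ → Adjacent x₀ y₀ →
               Parallel (Close (suc m)) (Close m) K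
    parallel Kx₀ Ky₀ x₀y₀ x Kx y = mk⇔ proj₂ λ xy → saturated xy , xy
      where
      saturated : Close (suc m) x y → saturation (Close m) K y
      saturated xy with dist x y ≤? m
      ... | yes xy' = x , Kx , xy'
      ... | no ¬xy with close-in-K-or-monochromatic Kx (close⇒adjacent xy ¬xy)
      ...   | inj₁ close-v = close-v
      ...   | inj₂ pair = ⊥-elim (adjacent-in-K⇒¬monochromatic Kx₀ Ky₀ x₀y₀ pair)

    orthogonal : MonochromaticPair → Orthogonal (Close (suc m)) (Close m) K
    orthogonal pair x Kx y = mk⇔ inner λ xy → (x , Kx , xy) , ≤-trans xy (n≤1+n m)
      where
      inner : saturation (Close m) K y × Close (suc m) x y → Close m x y
      inner ((w , Kw , wy) , xy) with dist x y ≤? m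
      ... | yes xy' = xy'
      ... | no ¬xy = ⊥-elim (adjacent-in-K⇒¬monochromatic Kx Kw xw pair)
        where
        xw : Adjacent x w
        xw = close⇒adjacent (close-trans xy (≤-trans (close-sym wy) (n≤1+n m)))
                            (λ xw → ¬xy (close-trans xw wy))

    K-point-with-adjacent : (Σ X λ p → Σ X λ p' → Adjacent p p') →
      Σ X λ x₀ → Σ X λ q → K x₀ × Adjacent x₀ q
    K-point-with-adjacent (p , p' , pp') with χ-onto idᴵ (χ p)
    ... | _ , (x₀ , Kx₀ , _) , _ = x₀ , to h p' , Kx₀ , x₀q
      where
      h : Isometry M
      h = proj₁ (homogeneous p x₀)
      x₀q : Adjacent x₀ (to h p')
      x₀q = trans (cong (λ z → dist z (to h p')) (sym (proj₂ (homogeneous p x₀))))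
                  (trans (dist-preserved h p p') pp')

    splittable : (Σ X λ p → Σ X λ p' → Adjacent p p') →
      Parallel (Close (suc m)) (Close m) K ⊎ Orthogonal (Close (suc m)) (Close m) K
    splittable scale with K-point-with-adjacent scale
    ... | x₀ , q , Kx₀ , x₀q with close-in-K-or-monochromatic Kx₀ x₀q
    ...   | inj₁ (v , Kv , vq) = inj₁ (parallel Kx₀ Kv (adjacent-close x₀q vq))
    ...   | inj₂ pair          = inj₂ (orthogonal pair)

theorem3p1 : (X : Set) (n : ℕ) (M : FiniteScaleUltrametric X n) →
    IsometricallyHomogeneous M →
    (K : X → Set) → Kaleidoscopical M K →
    (k : Fin n) →
      Parallel (E M (Fin.suc k)) (E M (inject₁ k)) K
      ⊎ Orthogonal (E M (Fin.suc k)) (E M (inject₁ k)) K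
theorem3p1 X n M homogeneous K κ k =
  -- E M i unfolds to Close M (toℕ i), so only toℕ (inject₁ k) ≡ toℕ k is needed.
  subst (λ t → Parallel (E M (Fin.suc k)) (Close M t) K
               ⊎ Orthogonal (E M (Fin.suc k)) (Close M t) K)
        (sym (toℕ-inject₁ k))
        (Level.splittable M homogeneous κ (toℕ k) (scale-onto-suc M k))
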